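{- Let $n$ be a prime, let $a,b\in\mathbb{Z}_n$ be nonzero, and let $v,w\in\{1,\ldots,n-1\}$ be coprime integers with $va=wb$ in $\mathbb{Z}_n$. Let $t,s$ be integers with $t\ge v$ and $s\ge w$. Put $z=a/w=b/v\in\mathbb{Z}_n$ and $u=tw+sv-2(vw-v-w+1)$. Then there exists $c\in\mathbb{Z}_n$ such that $c+AP(z,u)\subseteq AP(a,t)+AP(b,s)$.
   Context: $\mathbb{Z}_n=\mathbb{Z}/n\mathbb{Z}$ (a field since $n$ is prime; $a/w$ means $a\cdot w^{ -1}$). For $a\in\mathbb{Z}_n$ and a nonnegative integer $k$, $AP(a,k)=\{0,a,2a,\ldots,ka\}$. For sets $X,Y$, $X+Y=\{x+y:x\in X,y\in Y\}$ and $c+X=\{c+x:x\in X\}$. -}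

module Defs where

open import Data.Nat using (ℕ; _+_; _*_; _≤_; _<_; NonZero)
open import Data.Nat.DivMod using (_%_)
open import Data.Product using (Σ; _×_; ∃-syntax)
open import Relation.Binary.PropositionalEquality using (_≡_)

-- Z_n is represented by ℕ with equality taken modulo n (n prime, so NonZero).
-- x ≡[ n ] y  means  x = y in Z_n.
_≡[_]_ : ℕ → (n : ℕ) → .{{NonZero n}} → ℕ → Set
x ≡[ n ] y = x % n ≡ y % n

InAP : (n : ℕ) → .{{NonZero n}} → ℕ → ℕ → ℕ → Set
InAP n a k x = ∃[ i ] (i ≤ k × x ≡[ n ] (i * a))

InSumAP : (n : ℕ) → .{{NonZero n}} → ℕ → ℕ → ℕ → ℕ → ℕ → Set
InSumAP n a t b s x = ∃[ i ] ∃[ j ] (i ≤ t × j ≤ s × x ≡[ n ] (i * a + j * b))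

TranslateAPSubset : (n : ℕ) → .{{NonZero n}} → (c z u a t b s : ℕ) → Set
TranslateAPSubset n c z u a t b s =
  ∀ x → InAP n z u x → InSumAP n a t b s (c + x)

{-# OPTIONS --safe #-}
-- Put m = (v-1)(w-1). Every integer x with m ≤ x ≤ tw + sv - m is i·w + j·v with
-- 0 ≤ i ≤ t and 0 ≤ j ≤ s: Sylvester's argument gives such a representation with i < v,
-- and while j > s the exchange (i, j) ↦ (i + v, j - w) keeps i ≤ t. This window has
-- length u, and since w·z = a and v·z = b in Z_n, multiplying it by z places
-- m·z + AP(z, u) inside AP(a, t) + AP(b, s).
module Submission where

open import Defs
open import Data.Nat using (ℕ; suc; _+_; _*_; _∸_; _≤_; _<_; NonZero; >-nonZero; >-nonZero⁻¹; _≤?_)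
open import Data.Nat.Properties
open import Algebra.Properties.CommutativeSemigroup *-commutativeSemigroup using (x∙yz≈y∙xz)
open import Data.Nat.DivMod using (_%_; _/_; %-distribˡ-+; %-distribˡ-*; [m+kn]%n≡m%n; [m+n]%n≡m%n; m%n%n≡m%n; m%n<n; m≡m%n+[m/n]*n)
open import Data.Nat.GCD using (module Bézout)
open import Data.Nat.Coprimality using (Coprime; coprime-Bézout; prime⇒coprime)
open import Data.Nat.Induction using (<-rec)
open import Data.Nat.Primality using (Prime)
open import Data.Nat.Tactic.RingSolver using (solve-∀)
open import Data.Product using (_×_; _,_; ∃-syntax)
open import Relation.Nullary using (yes; no)
open import Relation.Binary.PropositionalEquality using (_≡_; _≢_; refl; sym; trans; cong; cong₂; module ≡-Reasoning)

module _ {d : ℕ} .{{_ : NonZero d}} where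

  +-cong-mod : ∀ {x x′ y y′} → x ≡[ d ] x′ → y ≡[ d ] y′ → (x + y) ≡[ d ] (x′ + y′)
  +-cong-mod {x} {x′} {y} {y′} x≡x′ y≡y′ = begin
    (x + y) % d                  ≡⟨ %-distribˡ-+ x y d ⟩
    (x % d + y % d) % d          ≡⟨ cong₂ (λ p q → (p + q) % d) x≡x′ y≡y′ ⟩
    (x′ % d + y′ % d) % d        ≡⟨ %-distribˡ-+ x′ y′ d ⟨
    (x′ + y′) % d                ∎
    where open ≡-Reasoning

  *-cong-mod : ∀ {x x′ y y′} → x ≡[ d ] x′ → y ≡[ d ] y′ → (x * y) ≡[ d ] (x′ * y′)
  *-cong-mod {x} {x′} {y} {y′} x≡x′ y≡y′ = begin
    (x * y) % d                  ≡⟨ %-distribˡ-* x y d ⟩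
    (x % d * (y % d)) % d        ≡⟨ cong₂ (λ p q → (p * q) % d) x≡x′ y≡y′ ⟩
    (x′ % d * (y′ % d)) % d      ≡⟨ %-distribˡ-* x′ y′ d ⟨
    (x′ * y′) % d                ∎
    where open ≡-Reasoning

inverse-mod : ∀ {m w} .{{_ : NonZero m}} → Coprime m w → ∃[ α ] ((α * w) ≡[ m ] 1)
inverse-mod {m} {w} m⊥w with coprime-Bézout m⊥w
... | Bézout.-+ x y 1+xm≡yw = y , (begin
  (y * w) % m        ≡⟨ cong (_% m) 1+xm≡yw ⟨
  (1 + x * m) % m    ≡⟨ [m+kn]%n≡m%n 1 x m ⟩
  1 % m              ∎)
  where open ≡-Reasoning
-- Here y·w ≡ -1 (mod m), so (m - 1)·y is an inverse of w.
inverse-mod {suc m′} {w} m⊥w | Bézout.+- x y 1+yw≡xm = m′ * y , (begin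
  (m′ * y * w) % m               ≡⟨ [m+n]%n≡m%n (m′ * y * w) m ⟨
  (m′ * y * w + m) % m           ≡⟨ cong (_% m) (rearrange m′ y w) ⟩
  (1 + m′ * (1 + y * w)) % m     ≡⟨ cong (λ e → (1 + m′ * e) % m) 1+yw≡xm ⟩
  (1 + m′ * (x * m)) % m         ≡⟨ cong (λ e → (1 + e) % m) (*-assoc m′ x m) ⟨
  (1 + m′ * x * m) % m           ≡⟨ [m+kn]%n≡m%n 1 (m′ * x) m ⟩
  1 % m                          ∎)
  where
  open ≡-Reasoning
  m = suc m′
  rearrange : ∀ m′ y w → m′ * y * w + suc m′ ≡ 1 + m′ * (1 + y * w)
  rearrange = solve-∀

*-cancelˡ-mod : ∀ {m w x y} .{{_ : NonZero m}} → Coprime m w → (w * x) ≡[ m ] (w * y) → x ≡[ m ] y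
*-cancelˡ-mod {m} {w} {x} {y} m⊥w wx≡wy with inverse-mod m⊥w
... | α , αw≡1 = begin
  x % m              ≡⟨ cong (_% m) (*-identityˡ x) ⟨
  (1 * x) % m        ≡⟨ *-cong-mod αw≡1 refl ⟨
  (α * w * x) % m    ≡⟨ cong (_% m) (*-assoc α w x) ⟩
  (α * (w * x)) % m  ≡⟨ *-cong-mod {x = α} refl wx≡wy ⟩
  (α * (w * y)) % m  ≡⟨ cong (_% m) (*-assoc α w y) ⟨
  (α * w * y) % m    ≡⟨ *-cong-mod αw≡1 refl ⟩
  (1 * y) % m        ≡⟨ cong (_% m) (*-identityˡ y) ⟩
  y % m              ∎
  where open ≡-Reasoning

InSumAPℕ : ℕ → ℕ → ℕ → ℕ → ℕ → Set
InSumAPℕ a t b s x = ∃[ i ] ∃[ j ] (i ≤ t × j ≤ s × x ≡ i * a + j * b)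

sylvester : ∀ {v w x} .{{_ : NonZero v}} .{{_ : NonZero w}} → Coprime v w →
            (v ∸ 1) * (w ∸ 1) ≤ x → ∃[ i ] ∃[ j ] (i < v × x ≡ i * w + j * v)
sylvester {v@(suc v′)} {w@(suc w′)} {x} v⊥w m≤x with inverse-mod v⊥w
... | α , αw≡1 = i , Q ∸ q , i<v , x≡iw+[Q∸q]v
  where
  i = (x * α) % v
  r = x % v
  q = (i * w) / v
  Q = x / v

  i<v : i < v
  i<v = m%n<n (x * α) v

  iw≡x : (i * w) ≡[ v ] x
  iw≡x = begin
    (i * w) % v        ≡⟨ *-cong-mod {v} {i} {x * α} {w} (m%n%n≡m%n (x * α) v) refl ⟩
    (x * α * w) % v    ≡⟨ cong (_% v) (*-assoc x α w) ⟩
    (x * (α * w)) % v  ≡⟨ *-cong-mod {v} {x} {x} {α * w} refl αw≡1 ⟩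
    (x * 1) % v        ≡⟨ cong (_% v) (*-identityʳ x) ⟩
    x % v              ∎
    where open ≡-Reasoning

  x≡r+Qv : x ≡ r + Q * v
  x≡r+Qv = m≡m%n+[m/n]*n x v

  iw≡r+qv : i * w ≡ r + q * v
  iw≡r+qv = trans (m≡m%n+[m/n]*n (i * w) v) (cong (_+ q * v) iw≡x)

  -- i·w and x share the remainder r, and i·w ≤ (v-1)·w < x + v.
  q≤Q : q ≤ Q
  q≤Q = ≤-pred (*-cancelʳ-< v q (suc Q) (+-cancelˡ-< r (q * v) (suc Q * v) (begin-strict
    r + q * v       ≡⟨ iw≡r+qv ⟨
    i * w           ≤⟨ *-monoˡ-≤ w (≤-pred i<v) ⟩
    v′ * w          ≡⟨ *-suc v′ w′ ⟩
    v′ + v′ * w′    ≡⟨ +-comm v′ (v′ * w′) ⟩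
    v′ * w′ + v′    <⟨ +-mono-≤-< m≤x (n<1+n v′) ⟩
    x + v           ≡⟨ cong (_+ v) x≡r+Qv ⟩
    r + Q * v + v   ≡⟨ +-assoc r (Q * v) v ⟩
    r + (Q * v + v) ≡⟨ cong (r +_) (+-comm (Q * v) v) ⟩
    r + suc Q * v   ∎)))
    where open ≤-Reasoning

  x≡iw+[Q∸q]v : x ≡ i * w + (Q ∸ q) * v
  x≡iw+[Q∸q]v = begin
    x                        ≡⟨ x≡r+Qv ⟩
    r + Q * v                ≡⟨ cong (λ e → r + e * v) (m+[n∸m]≡n q≤Q) ⟨
    r + (q + (Q ∸ q)) * v    ≡⟨ split r q (Q ∸ q) v ⟩
    r + q * v + (Q ∸ q) * v  ≡⟨ cong (_+ (Q ∸ q) * v) iw≡r+qv ⟨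
    i * w + (Q ∸ q) * v      ∎
    where
    open ≡-Reasoning
    split : ∀ r q k v → r + (q + k) * v ≡ r + q * v + k * v
    split = solve-∀

exchange-room : ∀ {v w t s x i j} .{{_ : NonZero v}} .{{_ : NonZero w}} →
                s < j → x ≡ i * w + j * v → x + (v ∸ 1) * (w ∸ 1) ≤ t * w + s * v → i + v ≤ t
exchange-room {v@(suc v′)} {w@(suc w′)} {t} {s} {x} {i} {j} s<j x≡iw+jv upper =
  ≤-pred (*-cancelʳ-< w (i + v) (suc t) (begin-strict
    (i + v) * w              ≡⟨ expand i v′ w′ ⟩
    i * w + v + m + w′       ≤⟨ +-monoˡ-≤ w′ iw+v+m≤tw ⟩
    t * w + w′               <⟨ +-monoʳ-< (t * w) (n<1+n w′) ⟩
    t * w + w                ≡⟨ +-comm (t * w) w ⟩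
    suc t * w                ∎))
  where
  open ≤-Reasoning
  m = v′ * w′
  expand : ∀ i v′ w′ → (i + suc v′) * suc w′ ≡ i * suc w′ + suc v′ + v′ * w′ + w′
  expand = solve-∀
  regroup : ∀ i w v m s → i * w + v + m + s * v ≡ i * w + suc s * v + m
  regroup = solve-∀
  iw+v+m≤tw : i * w + v + m ≤ t * w
  iw+v+m≤tw = +-cancelʳ-≤ (s * v) (i * w + v + m) (t * w) (begin
    i * w + v + m + s * v     ≡⟨ regroup i w v m s ⟩
    i * w + suc s * v + m     ≤⟨ +-monoˡ-≤ m (+-monoʳ-≤ (i * w) (*-monoˡ-≤ v s<j)) ⟩
    i * w + j * v + m         ≡⟨ cong (_+ m) x≡iw+jv ⟨
    x + m                     ≤⟨ upper ⟩
    t * w + s * v             ∎)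

exchange : ∀ {v w i j} → w ≤ j → i * w + j * v ≡ (i + v) * w + (j ∸ w) * v
exchange {v} {w} {i} {j} w≤j = begin
  i * w + j * v                  ≡⟨ cong (λ e → i * w + e * v) (m+[n∸m]≡n w≤j) ⟨
  i * w + (w + (j ∸ w)) * v      ≡⟨ swap i w v (j ∸ w) ⟩
  (i + v) * w + (j ∸ w) * v      ∎
  where
  open ≡-Reasoning
  swap : ∀ i w v k → i * w + (w + k) * v ≡ (i + v) * w + k * v
  swap = solve-∀

exchange-down : ∀ {v w t s x} .{{_ : NonZero v}} .{{_ : NonZero w}} → w ≤ s →
                x + (v ∸ 1) * (w ∸ 1) ≤ t * w + s * v →
                ∀ j i → i ≤ t → x ≡ i * w + j * v → InSumAPℕ w t v s x
exchange-down {v} {w} {t} {s} {x} w≤s upper = <-rec P step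
  where
  P : ℕ → Set
  P j = ∀ i → i ≤ t → x ≡ i * w + j * v → InSumAPℕ w t v s x
  step : ∀ j → (∀ {k} → k < j → P k) → P j
  step j rec i i≤t x≡iw+jv with j ≤? s
  ... | yes j≤s = i , j , i≤t , j≤s , x≡iw+jv
  ... | no j≰s = rec (∸-monoʳ-< (>-nonZero⁻¹ w) w≤j) (i + v)
                   (exchange-room s<j x≡iw+jv upper) (trans x≡iw+jv (exchange {i = i} w≤j))
    where
    s<j = ≰⇒> j≰s
    w≤j = ≤-trans w≤s (<⇒≤ s<j)

window⊆sumAPℕ : ∀ {v w t s x} .{{_ : NonZero v}} .{{_ : NonZero w}} → Coprime v w → v ≤ t → w ≤ s →
                (v ∸ 1) * (w ∸ 1) ≤ x → x + (v ∸ 1) * (w ∸ 1) ≤ t * w + s * v → InSumAPℕ w t v s x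
window⊆sumAPℕ v⊥w v≤t w≤s lower upper with sylvester v⊥w lower
... | i , j , i<v , x≡iw+jv = exchange-down w≤s upper j i (≤-trans (<⇒≤ i<v) v≤t) x≡iw+jv

v*w+1∸v∸w≡[v∸1]*[w∸1] : ∀ v w .{{_ : NonZero v}} .{{_ : NonZero w}} → v * w + 1 ∸ v ∸ w ≡ (v ∸ 1) * (w ∸ 1)
v*w+1∸v∸w≡[v∸1]*[w∸1] v@(suc v′) w@(suc w′) = begin
  v * w + 1 ∸ v ∸ w          ≡⟨ cong (λ e → e ∸ v ∸ w) (expand v′ w′) ⟩
  v′ * w′ + w + v ∸ v ∸ w    ≡⟨ cong (_∸ w) (m+n∸n≡m (v′ * w′ + w) v) ⟩
  v′ * w′ + w ∸ w            ≡⟨ m+n∸n≡m (v′ * w′) w ⟩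
  v′ * w′                    ∎
  where
  open ≡-Reasoning
  expand : ∀ v′ w′ → suc v′ * suc w′ + 1 ≡ v′ * w′ + suc w′ + suc v′
  expand = solve-∀

frobenius-window : ∀ {v w t s k} .{{_ : NonZero v}} .{{_ : NonZero w}} → v ≤ t → w ≤ s →
                   k ≤ t * w + s * v ∸ 2 * (v * w + 1 ∸ v ∸ w) →
                   (v ∸ 1) * (w ∸ 1) + k + (v ∸ 1) * (w ∸ 1) ≤ t * w + s * v
frobenius-window {v@(suc v′)} {w@(suc w′)} {t} {s} {k} v≤t w≤s k≤u = begin
  m + k + m              ≡⟨ cong (_+ m) (+-comm m k) ⟩
  k + m + m              ≡⟨ +-assoc k m m ⟩
  k + (m + m)            ≤⟨ +-monoˡ-≤ (m + m) k≤N∸[m+m] ⟩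
  N ∸ (m + m) + (m + m)  ≡⟨ m∸n+n≡m m+m≤N ⟩
  N                      ∎
  where
  open ≤-Reasoning
  m = v′ * w′
  N = t * w + s * v
  m+m≤N : m + m ≤ N
  m+m≤N = +-mono-≤ (*-mono-≤ (≤-trans (n≤1+n v′) v≤t) (n≤1+n w′))
                   (≤-trans (≤-reflexive (*-comm v′ w′)) (*-mono-≤ (≤-trans (n≤1+n w′) w≤s) (n≤1+n v′)))
  k≤N∸[m+m] : k ≤ N ∸ (m + m)
  k≤N∸[m+m] = ≤-trans k≤u (≤-reflexive (trans (cong (λ e → N ∸ 2 * e) (v*w+1∸v∸w≡[v∸1]*[w∸1] v w))
                                               (cong (λ e → N ∸ (m + e)) (+-identityʳ m))))

InSumAPℕ⇒InSumAP : ∀ {n} .{{_ : NonZero n}} {w t v s z a b x} → (w * z) ≡[ n ] a → (v * z) ≡[ n ] b →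
                   InSumAPℕ w t v s x → InSumAP n a t b s (x * z)
InSumAPℕ⇒InSumAP {n} {w} {v = v} {z = z} {a} {b} {x} wz≡a vz≡b (i , j , i≤t , j≤s , x≡iw+jv) =
  i , j , i≤t , j≤s , (begin
    (x * z) % n                      ≡⟨ cong (λ e → (e * z) % n) x≡iw+jv ⟩
    ((i * w + j * v) * z) % n        ≡⟨ cong (_% n) (distribute i w j v z) ⟩
    (i * (w * z) + j * (v * z)) % n  ≡⟨ +-cong-mod {n} {i * (w * z)} {i * a} (*-cong-mod {n} {i} refl wz≡a)
                                                                            (*-cong-mod {n} {j} refl vz≡b) ⟩
    (i * a + j * b) % n              ∎)
  where
  open ≡-Reasoning
  distribute : ∀ i w j v z → (i * w + j * v) * z ≡ i * (w * z) + j * (v * z)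
  distribute = solve-∀

InSumAP-resp : ∀ {n} .{{_ : NonZero n}} {a t b s x y} → x ≡[ n ] y → InSumAP n a t b s y → InSumAP n a t b s x
InSumAP-resp x≡y (i , j , i≤t , j≤s , y≡ia+jb) = i , j , i≤t , j≤s , trans x≡y y≡ia+jb

proposition9 : (n : ℕ) → .{{_ : NonZero n}} → Prime n →
    (a b : ℕ) → a < n → b < n → a ≢ 0 → b ≢ 0 →
    (v w : ℕ) → 1 ≤ v → v < n → 1 ≤ w → w < n → Coprime v w →
    (v * a) ≡[ n ] (w * b) →
    (t s : ℕ) → v ≤ t → w ≤ s →
    (z : ℕ) → z < n → (w * z) ≡[ n ] a →
    ∃[ c ] (c < n × TranslateAPSubset n c z (t * w + s * v ∸ 2 * (v * w + 1 ∸ v ∸ w)) a t b s)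
proposition9 n n-prime a b _ _ _ _ v w 1≤v _ 1≤w w<n v⊥w va≡wb t s v≤t w≤s z _ wz≡a =
  (m * z) % n , m%n<n (m * z) n , λ x (k , k≤u , x≡kz) →
    InSumAP-resp (translate x≡kz) (InSumAPℕ⇒InSumAP wz≡a vz≡b
      (window⊆sumAPℕ v⊥w v≤t w≤s (m≤m+n m k) (frobenius-window v≤t w≤s k≤u)))
  where
  instance
    v≢0 : NonZero v
    v≢0 = >-nonZero 1≤v
    w≢0 : NonZero w
    w≢0 = >-nonZero 1≤w
  m = (v ∸ 1) * (w ∸ 1)

  vz≡b : (v * z) ≡[ n ] b
  vz≡b = *-cancelˡ-mod (prime⇒coprime n-prime w<n) (begin
    (w * (v * z)) % n  ≡⟨ cong (_% n) (x∙yz≈y∙xz w v z) ⟩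
    (v * (w * z)) % n  ≡⟨ *-cong-mod {n} {v} refl wz≡a ⟩
    (v * a) % n        ≡⟨ va≡wb ⟩
    (w * b) % n        ∎)
    where open ≡-Reasoning

  translate : ∀ {x k} → x ≡[ n ] (k * z) → ((m * z) % n + x) ≡[ n ] ((m + k) * z)
  translate {k = k} x≡kz = trans (+-cong-mod {n} {(m * z) % n} {m * z} (m%n%n≡m%n (m * z) n) x≡kz)
                                 (cong (_% n) (sym (*-distribʳ-+ z m k)))
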